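{- If $T$ is a tree with an even number of edges, then there exists a vertex $x\in V(T)$ such that every connected component of $T-x$ has an even number of edges. -}

module Defs where

open import Data.Nat using (ℕ; zero; suc; _+_; _≤_)
open import Data.Nat.Divisibility using (_∣_)
open import Data.Fin using (Fin; _<_)
open import Data.Bool using (Bool; true; false; T)
open import Data.List using (List; []; _∷_; length; allFin; filter)
open import Data.List.Relation.Unary.AllPairs using (AllPairs)
open import Data.List.Relation.Unary.Unique.Propositional using (Unique)
open import Data.List.Membership.Propositional using (_∈_)
open import Data.Product using (_×_; Σ; _,_; ∃; ∃-syntax)
open import Relation.Binary.PropositionalEquality using (_≡_; _≢_)
open import Relation.Nullary using (¬_)
open import Function.Bundles using (_⇔_)

record Graph (n : ℕ) : Set where
  field
    adj     : Fin n → Fin n → Bool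
    sym     : ∀ u v → adj u v ≡ adj v u
    irrefl  : ∀ v → adj v v ≡ false
open Graph public

Adj : ∀ {n} → Graph n → Fin n → Fin n → Set
Adj G u v = T (adj G u v)

-- Reach G x u v : there is a walk from u to v in G all of whose vertices
-- avoid the vertex x (i.e. a walk in G - x). Both ends must differ from x.
data ReachAvoid {n} (G : Graph n) (x : Fin n) : Fin n → Fin n → Set where
  here : ∀ {u} → u ≢ x → ReachAvoid G x u u
  step : ∀ {u v w} → u ≢ x → Adj G u v → ReachAvoid G x v w → ReachAvoid G x u w

data Reach {n} (G : Graph n) : Fin n → Fin n → Set where
  here : ∀ {u} → Reach G u u
  step : ∀ {u v w} → Adj G u v → Reach G v w → Reach G u w

Connected : ∀ {n} → Graph n → Set
Connected G = ∀ u v → Reach G u v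

data PathList {n} (G : Graph n) : List (Fin n) → Set where
  single : ∀ {v} → PathList G (v ∷ [])
  cons   : ∀ {u v vs} → Adj G u v → PathList G (v ∷ vs) → PathList G (u ∷ v ∷ vs)

-- A cycle: distinct vertices v₀ v₁ … v_k with k ≥ 2, consecutive ones
-- adjacent, and v_k adjacent to v₀.
record Cycle {n} (G : Graph n) : Set where
  field
    first  : Fin n
    rest   : List (Fin n)
    last   : Fin n
    long   : 2 ≤ length rest + 1
    path   : PathList G (first ∷ rest Data.List.++ (last ∷ []))
    distinct : Unique (first ∷ rest Data.List.++ (last ∷ []))
    closes : Adj G last first

Acyclic : ∀ {n} → Graph n → Set
Acyclic G = ¬ Cycle G

-- A tree: connected and acyclic (nonempty vertex set is imposed in the statement).
IsTree : ∀ {n} → Graph n → Set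
IsTree G = Connected G × Acyclic G

-- Edges of G, each counted once as an ordered pair (u , v) with u < v.
edges : ∀ {n} → Graph n → List (Fin n × Fin n)
edges {n} G = filter dec (cartesian (allFin n))
  where
    open import Data.List using (cartesianProduct; concatMap; map)
    cartesian : List (Fin n) → List (Fin n × Fin n)
    cartesian xs = cartesianProduct xs xs
    open import Relation.Nullary using (Dec)
    open import Data.Fin using (_<?_)
    open import Relation.Nullary.Decidable using (_×-dec_)
    open import Data.Bool.Properties using (T?)
    dec : (p : Fin n × Fin n) → Dec (Data.Fin._<_ (Data.Product.proj₁ p) (Data.Product.proj₂ p) × Adj G (Data.Product.proj₁ p) (Data.Product.proj₂ p))
    dec (u , v) = (u <? v) ×-dec T? (adj G u v)

numEdges : ∀ {n} → Graph n → ℕ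
numEdges G = length (edges G)

Even : ℕ → Set
Even m = 2 ∣ m

InComponentEdge : ∀ {n} → Graph n → (x y : Fin n) → Fin n × Fin n → Set
InComponentEdge G x y (u , v) = (u < v) × Adj G u v × ReachAvoid G x y u × ReachAvoid G x y v

EnumeratesComponentEdges : ∀ {n} → Graph n → (x y : Fin n) → List (Fin n × Fin n) → Set
EnumeratesComponentEdges G x y E =
  Unique E × (∀ e → (e ∈ E) ⇔ InComponentEdge G x y e)

-- Every connected component of G - x has an even number of edges.
-- (Each component is the component of some y ≠ x; its edge count is the
-- length of any duplicate-free enumeration of its edge set.)
AllComponentsEven : ∀ {n} → Graph n → Fin n → Set
AllComponentsEven G x =
  ∀ y → y ≢ x → ∀ E → EnumeratesComponentEdges G x y E → Even (length E)

-- For an edge xc write e(x, c) for the number of edges of the component of c in T − x.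
-- Deleting xc splits T into the components of c in T − x and of x in T − c, so
-- |E(T)| = e(x, c) + 1 + e(c, x), and when |E(T)| is even, e(x, c) odd forces e(c, x) even.
-- Walk through T keeping e(c, x) even for the last edge xc: either every component of T − c
-- is even and c is the vertex sought, or some neighbour d has e(c, d) odd; then d ≠ x,
-- e(d, c) is even, and e(c, d) < e(x, c) since the component of d in T − c lies strictly
-- inside that of c in T − x. So the walk stops.

module Submission where

open import Defs
open import Data.Nat using (ℕ; zero; suc; _+_; _<_; s≤s)
open import Data.Nat.Properties using (+-suc; m≤n+m; m<m+n; module ≤-Reasoning)
open import Data.Nat.Divisibility using (_∣?_; _∣0; ∣-refl; ∣m∣n⇒∣m+n; ∣m+n∣m⇒∣n)
open import Data.Nat.Induction using (<-wellFounded)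
open import Induction.WellFounded using (Acc; acc)
open import Data.Fin using (Fin; _≟_) renaming (zero to zeroᶠ; _<_ to _<ᶠ_; _<?_ to _<ᶠ?_)
open import Data.Fin.Properties using (all?; ¬∀⟶∃¬) renaming (<-cmp to <ᶠ-cmp; <-asym to <ᶠ-asym)
open import Data.Bool using (T)
open import Data.Bool.Properties using (T?)
open import Data.Empty using (⊥-elim)
open import Data.Product using (Σ; _×_; _,_; proj₁; proj₂; ∃-syntax)
open import Data.Sum using (_⊎_; inj₁; inj₂; [_,_]; map₂)
open import Data.List using (List; []; _∷_; _++_; length; filter; allFin; cartesianProduct)
open import Data.List.Properties using (filter-some; filter-≐)
open import Data.List.Relation.Unary.Any using (here; there)
open import Data.List.Relation.Unary.All using (All; []; _∷_)
open import Data.List.Relation.Unary.All.Properties using (¬Any⇒All¬)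
open import Data.List.Relation.Unary.AllPairs using ([]; _∷_)
open import Data.List.Relation.Unary.Unique.Propositional using (Unique)
open import Data.List.Relation.Unary.Unique.Propositional.Properties using (filter⁺; cartesianProduct⁺; allFin⁺)
open import Data.List.Membership.Propositional using (_∈_; lose)
open import Data.List.Membership.Propositional.Properties using (∈-filter⁺; ∈-filter⁻; ∈-cartesianProduct⁺; ∈-allFin)
open import Data.List.Membership.Propositional.Properties.WithK using (unique∧set⇒bag)
open import Data.List.Relation.Binary.BagAndSetEquality using (∼bag⇒↭)
open import Data.List.Relation.Binary.Permutation.Propositional.Properties using (↭-length)
open import Function.Base using (_∘_; const; case_of_)
open import Function.Bundles using (_⇔_; mk⇔; Equivalence)
open import Level using (0ℓ)
open import Relation.Nullary using (¬_; Dec; yes; no)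
open import Relation.Nullary.Decidable using (toSum; _×-dec_; _⊎-dec_; _→-dec_; decidable-stable)
open import Relation.Unary using (Pred; Decidable; _⊆_; _≐_; _∪_; _∩_; ∁)
open import Relation.Unary.Properties using (_∪?_; _∩?_; ∁?)
open import Relation.Binary.Definitions using (tri<; tri≈; tri>)
open import Relation.Binary.PropositionalEquality
  using (_≡_; _≢_; refl; trans; cong; subst; module ≡-Reasoning) renaming (sym to ≡-sym)

module _ {A : Set} where

  length-unique-≡ : {xs ys : List A} → Unique xs → Unique ys →
                    (∀ {z} → z ∈ xs ⇔ z ∈ ys) → length xs ≡ length ys
  length-unique-≡ xs! ys! xs≈ys = ↭-length (∼bag⇒↭ (unique∧set⇒bag xs! ys! xs≈ys))

  length-filter-∪ : {P Q : Pred A 0ℓ} (P? : Decidable P) (Q? : Decidable Q) → (∀ {a} → P a → ¬ Q a) →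
                    ∀ xs → length (filter (P? ∪? Q?) xs) ≡ length (filter P? xs) + length (filter Q? xs)
  length-filter-∪ P? Q? disjoint [] = refl
  length-filter-∪ P? Q? disjoint (a ∷ xs) with P? a | Q? a
  ... | yes p | yes q = ⊥-elim (disjoint p q)
  ... | yes _ | no _  = cong suc (length-filter-∪ P? Q? disjoint xs)
  ... | no _  | yes _ = trans (cong suc (length-filter-∪ P? Q? disjoint xs)) (≡-sym (+-suc _ _))
  ... | no _  | no _  = length-filter-∪ P? Q? disjoint xs

  length-filter-< : {P Q : Pred A 0ℓ} (P? : Decidable P) (Q? : Decidable Q) → P ⊆ Q →
                    ∀ {p} xs → p ∈ xs → Q p → ¬ P p → length (filter P? xs) < length (filter Q? xs)
  length-filter-< {P} {Q} P? Q? P⊆Q xs p∈xs Qp ¬Pp = begin-strict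
    length (filter P? xs)                            <⟨ m<m+n _ (filter-some Q∖P? (lose p∈xs (Qp , ¬Pp))) ⟩
    length (filter P? xs) + length (filter Q∖P? xs)  ≡⟨ length-filter-∪ P? Q∖P? (λ Pa (_ , ¬Pa) → ¬Pa Pa) xs ⟨
    length (filter (P? ∪? Q∖P?) xs)                  ≡⟨ cong length (filter-≐ (P? ∪? Q∖P?) Q? P∪Q∖P≐Q xs) ⟩
    length (filter Q? xs)                            ∎
    where
      open ≤-Reasoning
      Q∖P? = Q? ∩? ∁? P?
      P∪Q∖P≐Q : (P ∪ (Q ∩ ∁ P)) ≐ Q
      P∪Q∖P≐Q = [ P⊆Q , proj₁ ] , λ {a} Qa → map₂ (Qa ,_) (toSum (P? a))

  length-filter-≡1 : {P : Pred A 0ℓ} (P? : Decidable P) {xs : List A} {p : A} → Unique xs →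
                     p ∈ xs → P p → (∀ {q} → P q → q ≡ p) → length (filter P? xs) ≡ 1
  length-filter-≡1 P? {xs} {p} xs! p∈xs Pp only-p = length-unique-≡ (filter⁺ P? xs!) ([] ∷ []) (mk⇔ to from)
    where
      to : ∀ {z} → z ∈ filter P? xs → z ∈ p ∷ []
      to z∈ = here (only-p (proj₂ (∈-filter⁻ P? {xs = xs} z∈)))
      from : ∀ {z} → z ∈ p ∷ [] → z ∈ filter P? xs
      from (here refl) = ∈-filter⁺ P? p∈xs Pp

even⊎even-suc : ∀ m → Even m ⊎ Even (suc m)
even⊎even-suc zero = inj₁ (2 ∣0)
even⊎even-suc (suc m) with even⊎even-suc m
... | inj₁ even-m = inj₂ (∣m∣n⇒∣m+n ∣-refl even-m)
... | inj₂ even-1+m = inj₁ even-1+m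

even-+-suc : ∀ m n → Even (m + suc n) → ¬ Even m → Even n
even-+-suc m n even-sum odd-m with even⊎even-suc m
... | inj₁ even-m = ⊥-elim (odd-m even-m)
... | inj₂ even-1+m = ∣m+n∣m⇒∣n (subst Even (+-suc m n) even-sum) even-1+m

module Walks {n : ℕ} (G : Graph n) where

  open import Data.List.Membership.DecPropositional (_≟_ {n}) using (_∈?_)

  adj-sym : ∀ {u v} → Adj G u v → Adj G v u
  adj-sym {u} {v} = subst T (Graph.sym G u v)

  adj⇒≢ : ∀ {u v} → Adj G u v → u ≢ v
  adj⇒≢ {u} uv refl = subst T (irrefl G u) uv

  avoid-src : ∀ {x u v} → ReachAvoid G x u v → u ≢ x
  avoid-src (here u≢x)     = u≢x
  avoid-src (step u≢x _ _) = u≢x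

  avoid-tgt : ∀ {x u v} → ReachAvoid G x u v → v ≢ x
  avoid-tgt (here v≢x)   = v≢x
  avoid-tgt (step _ _ w) = avoid-tgt w

  avoid-trans : ∀ {x u v w} → ReachAvoid G x u v → ReachAvoid G x v w → ReachAvoid G x u w
  avoid-trans (here _)        w = w
  avoid-trans (step u≢x uv r) w = step u≢x uv (avoid-trans r w)

  avoid-snoc : ∀ {x u v w} → ReachAvoid G x u v → Adj G v w → w ≢ x → ReachAvoid G x u w
  avoid-snoc r vw w≢x = avoid-trans r (step (avoid-tgt r) vw (here w≢x))

  avoid-sym : ∀ {x u v} → ReachAvoid G x u v → ReachAvoid G x v u
  avoid-sym (here u≢x)      = here u≢x
  avoid-sym (step u≢x uv r) = avoid-snoc (avoid-sym r) (adj-sym uv) u≢x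

  reach-or-avoid : ∀ {x u v} c → ReachAvoid G x u v → ReachAvoid G x u c ⊎ ReachAvoid G c u v
  reach-or-avoid {u = u} c r with u ≟ c
  reach-or-avoid c r               | yes refl = inj₁ (here (avoid-src r))
  reach-or-avoid c (here _)        | no u≢c   = inj₂ (here u≢c)
  reach-or-avoid c (step u≢x uv r) | no u≢c with reach-or-avoid c r
  ... | inj₁ r′ = inj₁ (step u≢x uv r′)
  ... | inj₂ r′ = inj₂ (step u≢c uv r′)

  last-exit : ∀ {x u v} → Reach G u v → v ≢ x →
              ReachAvoid G x u v ⊎ ∃[ b ] Adj G x b × ReachAvoid G x b v
  last-exit here v≢x = inj₁ (here v≢x)
  last-exit {x} {u} (step uw r) v≢x with last-exit r v≢x | u ≟ x
  ... | inj₂ exit | _        = inj₂ exit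
  ... | inj₁ r′   | yes refl = inj₂ (_ , uw , r′)
  ... | inj₁ r′   | no u≢x   = inj₁ (step u≢x uw r′)

  last-exit-avoiding : ∀ {x c u v} → ReachAvoid G c u v → v ≢ x →
                       ReachAvoid G x u v ⊎ ∃[ b ] Adj G x b × b ≢ c × ReachAvoid G x b v
  last-exit-avoiding (here _) v≢x = inj₁ (here v≢x)
  last-exit-avoiding {x} {u = u} (step _ uw r) v≢x with last-exit-avoiding r v≢x | u ≟ x
  ... | inj₂ exit | _        = inj₂ exit
  ... | inj₁ r′   | yes refl = inj₂ (_ , uw , avoid-src r , r′)
  ... | inj₁ r′   | no u≢x   = inj₁ (step u≢x uw r′)

  vertices : ∀ {x u v} → ReachAvoid G x u v → List (Fin n)
  vertices {u = u} (here _)     = u ∷ []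
  vertices {u = u} (step _ _ r) = u ∷ vertices r

  interior : ∀ {x u v} → ReachAvoid G x u v → List (Fin n)
  interior (here _)             = []
  interior {u = u} (step _ _ r) = u ∷ interior r

  vertices≡interior∷ʳ : ∀ {x u v} (r : ReachAvoid G x u v) → vertices r ≡ interior r ++ v ∷ []
  vertices≡interior∷ʳ (here _)     = refl
  vertices≡interior∷ʳ (step _ _ r) = cong (_ ∷_) (vertices≡interior∷ʳ r)

  vertices-linked : ∀ {x u v} (r : ReachAvoid G x u v) → PathList G (vertices r)
  vertices-linked (here _)                  = single
  vertices-linked (step _ uv (here _))      = cons uv single
  vertices-linked (step _ uv r@(step _ _ _)) = cons uv (vertices-linked r)

  vertices-avoid : ∀ {x u v} (r : ReachAvoid G x u v) → All (x ≢_) (vertices r)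
  vertices-avoid (here u≢x)     = (u≢x ∘ ≡-sym) ∷ []
  vertices-avoid (step u≢x _ r) = (u≢x ∘ ≡-sym) ∷ vertices-avoid r

  IsPath : ∀ {x u v} → ReachAvoid G x u v → Set
  IsPath r = Unique (vertices r)

  suffix-from : ∀ {x u v a} (r : ReachAvoid G x u v) → a ∈ vertices r → IsPath r →
                Σ (ReachAvoid G x a v) IsPath
  suffix-from (here u≢x)      (here refl) r! = here u≢x , r!
  suffix-from r@(step _ _ _)  (here refl) r! = r , r!
  suffix-from (step _ _ r)    (there a∈)  (_ ∷ r!) = suffix-from r a∈ r!

  shortcut : ∀ {x u v} → ReachAvoid G x u v → Σ (ReachAvoid G x u v) IsPath
  shortcut (here u≢x) = here u≢x , [] ∷ []
  shortcut {u = u} (step u≢x uw r) with shortcut r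
  ... | p , p! with u ∈? vertices p
  ...   | yes u∈p = suffix-from p u∈p p!
  ...   | no  u∉p = step u≢x uw p , ¬Any⇒All¬ (vertices p) u∉p ∷ p!

module Pairs (n : ℕ) where

  Pair : Set
  Pair = Fin n × Fin n

  pairs : List Pair
  pairs = cartesianProduct (allFin n) (allFin n)

  pairs-unique : Unique pairs
  pairs-unique = cartesianProduct⁺ (allFin⁺ n) (allFin⁺ n)

  ∈-pairs : ∀ p → p ∈ pairs
  ∈-pairs (u , v) = ∈-cartesianProduct⁺ (∈-allFin u) (∈-allFin v)

module Edges {n : ℕ} (G : Graph n) where

  open Walks G using (adj-sym; adj⇒≢)
  open Pairs n using (Pair; pairs; pairs-unique; ∈-pairs)

  -- This is the test filtered by Defs.edges, so numEdges G reduces to length (filter isEdge? pairs).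
  IsEdge : Pred Pair 0ℓ
  IsEdge (u , v) = u <ᶠ v × Adj G u v

  isEdge? : Decidable IsEdge
  isEdge? (u , v) = (u <ᶠ? v) ×-dec T? (adj G u v)

  Joins : Fin n → Fin n → Pred Pair 0ℓ
  Joins x c (u , v) = (u ≡ x × v ≡ c) ⊎ (u ≡ c × v ≡ x)

  EdgeBetween : Fin n → Fin n → Pred Pair 0ℓ
  EdgeBetween x c = IsEdge ∩ Joins x c

  edgeBetween? : ∀ x c → Decidable (EdgeBetween x c)
  edgeBetween? x c (u , v) =
    isEdge? (u , v) ×-dec (((u ≟ x) ×-dec (v ≟ c)) ⊎-dec ((u ≟ c) ×-dec (v ≟ x)))

  edgeBetween-exists : ∀ {x c} → Adj G x c → ∃[ p ] EdgeBetween x c p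
  edgeBetween-exists {x} {c} xc with <ᶠ-cmp x c
  ... | tri< x<c _ _   = (x , c) , (x<c , xc) , inj₁ (refl , refl)
  ... | tri≈ _ x≡c _   = ⊥-elim (adj⇒≢ xc x≡c)
  ... | tri> _ _ c<x   = (c , x) , (c<x , adj-sym xc) , inj₂ (refl , refl)

  edgeBetween-unique : ∀ {x c p q} → EdgeBetween x c p → EdgeBetween x c q → p ≡ q
  edgeBetween-unique (_ , inj₁ (refl , refl)) (_ , inj₁ (refl , refl)) = refl
  edgeBetween-unique (_ , inj₂ (refl , refl)) (_ , inj₂ (refl , refl)) = refl
  edgeBetween-unique ((x<c , _) , inj₁ (refl , refl)) ((c<x , _) , inj₂ (refl , refl)) = ⊥-elim (<ᶠ-asym x<c c<x)
  edgeBetween-unique ((c<x , _) , inj₂ (refl , refl)) ((x<c , _) , inj₁ (refl , refl)) = ⊥-elim (<ᶠ-asym c<x x<c)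

  edgeBetween-count : ∀ {x c} → Adj G x c → length (filter (edgeBetween? x c) pairs) ≡ 1
  edgeBetween-count {x} {c} xc with edgeBetween-exists xc
  ... | p , p-xc = length-filter-≡1 (edgeBetween? x c) pairs-unique (∈-pairs p) p-xc
                     (λ q-xc → edgeBetween-unique q-xc p-xc)

module Tree {n : ℕ} (G : Graph n) (connected : Connected G) (acyclic : Acyclic G) where

  open Walks G
  open Pairs n
  open Edges G

  linked-neighbours-≡ : ∀ {x a b} → Adj G x a → Adj G x b →
                        ReachAvoid G x a b → a ≡ b
  linked-neighbours-≡ {x} {b = b} xa xb r with shortcut r
  ... | here _ , _ = refl
  ... | p@(step _ _ q) , p! = ⊥-elim (acyclic record
    { first    = x
    ; rest     = interior p
    ; last     = b
    ; long     = s≤s (m≤n+m 1 (length (interior q)))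
    ; path     = subst (PathList G ∘ (x ∷_)) (vertices≡interior∷ʳ p) (cons xa (vertices-linked p))
    ; distinct = subst (Unique ∘ (x ∷_)) (vertices≡interior∷ʳ p) (vertices-avoid p ∷ p!)
    ; closes   = adj-sym xb
    })

  neighbour-towards : ∀ {x v} → v ≢ x → ∃[ b ] Adj G x b × ReachAvoid G x b v
  neighbour-towards {x} {v} v≢x with last-exit (connected x v) v≢x
  ... | inj₁ r    = ⊥-elim (avoid-src r refl)
  ... | inj₂ exit = exit

  -- y and u lie in one component of G − x iff they are reached from x through the same neighbour.
  reachAvoid? : ∀ x y u → Dec (ReachAvoid G x y u)
  reachAvoid? x y u with y ≟ x | u ≟ x
  ... | yes y≡x | _       = no λ r → avoid-src r y≡x
  ... | no _    | yes u≡x = no λ r → avoid-tgt r u≡x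
  ... | no y≢x  | no u≢x  with neighbour-towards y≢x | neighbour-towards u≢x
  ...   | a , xa , ay | b , xb , bu with a ≟ b
  ...     | yes refl = yes (avoid-trans (avoid-sym ay) bu)
  ...     | no a≢b   =
    no λ r → a≢b (linked-neighbours-≡ xa xb (avoid-trans ay (avoid-trans r (avoid-sym bu))))

  sides : ∀ {x c} → Adj G x c → ∀ w → ReachAvoid G x c w ⊎ ReachAvoid G c x w
  sides {x} {c} xc w with w ≟ x
  ... | yes refl = inj₂ (here (adj⇒≢ xc))
  ... | no w≢x with neighbour-towards w≢x
  ...   | b , xb , bw with b ≟ c
  ...     | yes refl = inj₁ bw
  ...     | no b≢c with reach-or-avoid c bw
  ...       | inj₁ bc  = ⊥-elim (b≢c (linked-neighbours-≡ xb xc bc))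
  ...       | inj₂ bw′ = inj₂ (step (adj⇒≢ xc) xb bw′)

  sides-disjoint : ∀ {x c v} → Adj G x c → ReachAvoid G x c v → ¬ ReachAvoid G c x v
  sides-disjoint xc cv xv with last-exit-avoiding xv (avoid-tgt cv)
  ... | inj₁ r = avoid-src r refl
  ... | inj₂ (b , xb , b≢c , bv) = b≢c (linked-neighbours-≡ xb xc (avoid-trans bv (avoid-sym cv)))

  side-nested : ∀ {x c d u} → Adj G x c → Adj G c d → d ≢ x →
                ReachAvoid G c d u → ReachAvoid G x c u
  side-nested {x} xc cd d≢x du with reach-or-avoid x du
  ... | inj₁ dx  = ⊥-elim (d≢x (linked-neighbours-≡ cd (adj-sym xc) dx))
  ... | inj₂ du′ = step (adj⇒≢ xc ∘ ≡-sym) cd du′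

  crossing-edge : ∀ {x c u v} → Adj G x c → Adj G u v →
                  ReachAvoid G x c u → ReachAvoid G c x v → u ≡ c × v ≡ x
  crossing-edge {x} {c} {u} {v} xc uv cu xv with v ≟ x | u ≟ c
  ... | no v≢x   | _        = ⊥-elim (sides-disjoint xc (avoid-snoc cu uv v≢x) xv)
  ... | yes refl | no u≢c   = ⊥-elim (sides-disjoint xc cu (step (adj⇒≢ xc) (adj-sym uv) (here u≢c)))
  ... | yes refl | yes refl = refl , refl

  componentEdge? : ∀ x y → Decidable (InComponentEdge G x y)
  componentEdge? x y (u , v) =
    (u <ᶠ? v) ×-dec T? (adj G u v) ×-dec reachAvoid? x y u ×-dec reachAvoid? x y v

  componentSize : Fin n → Fin n → ℕ
  componentSize x y = length (filter (componentEdge? x y) pairs)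

  enumeration-length : ∀ {x y E} → EnumeratesComponentEdges G x y E → length E ≡ componentSize x y
  enumeration-length {x} {y} {E} (E! , E≈) =
    length-unique-≡ E! (filter⁺ (componentEdge? x y) pairs-unique) (mk⇔ to from)
    where
      to : ∀ {e} → e ∈ E → e ∈ filter (componentEdge? x y) pairs
      to {e} e∈E = ∈-filter⁺ (componentEdge? x y) (∈-pairs e) (Equivalence.to (E≈ e) e∈E)
      from : ∀ {e} → e ∈ filter (componentEdge? x y) pairs → e ∈ E
      from {e} e∈ = Equivalence.from (E≈ e) (proj₂ (∈-filter⁻ (componentEdge? x y) {xs = pairs} e∈))

  componentSize-cong : ∀ {x y z} → ReachAvoid G x y z → componentSize x z ≡ componentSize x y
  componentSize-cong {x} {y} {z} yz =
    cong length (filter-≐ (componentEdge? x z) (componentEdge? x y) (⊆ʳ , ⊆ˡ) pairs)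
    where
      ⊆ʳ : InComponentEdge G x z ⊆ InComponentEdge G x y
      ⊆ʳ (u<v , uv , zu , zv) = u<v , uv , avoid-trans yz zu , avoid-trans yz zv
      ⊆ˡ : InComponentEdge G x y ⊆ InComponentEdge G x z
      ⊆ˡ (u<v , uv , yu , yv) = u<v , uv , avoid-trans (avoid-sym yz) yu , avoid-trans (avoid-sym yz) yv

  edge-trichotomy : ∀ {x c} → Adj G x c →
                    IsEdge ≐ (InComponentEdge G x c ∪ (EdgeBetween x c ∪ InComponentEdge G c x))
  edge-trichotomy {x} {c} xc = split , join
    where
      split : IsEdge ⊆ (InComponentEdge G x c ∪ (EdgeBetween x c ∪ InComponentEdge G c x))
      split {u , v} (u<v , uv) with sides xc u | sides xc v
      ... | inj₁ cu | inj₁ cv = inj₁ (u<v , uv , cu , cv)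
      ... | inj₂ xu | inj₂ xv = inj₂ (inj₂ (u<v , uv , xu , xv))
      ... | inj₁ cu | inj₂ xv with crossing-edge xc uv cu xv
      ...   | refl , refl = inj₂ (inj₁ ((u<v , uv) , inj₂ (refl , refl)))
      split {u , v} (u<v , uv) | inj₂ xu | inj₁ cv with crossing-edge xc (adj-sym uv) cv xu
      ...   | refl , refl = inj₂ (inj₁ ((u<v , uv) , inj₁ (refl , refl)))
      join : (InComponentEdge G x c ∪ (EdgeBetween x c ∪ InComponentEdge G c x)) ⊆ IsEdge
      join (inj₁ (u<v , uv , _))         = u<v , uv
      join (inj₂ (inj₁ (edge , _)))      = edge
      join (inj₂ (inj₂ (u<v , uv , _)))  = u<v , uv

  numEdges≡ : ∀ {x c} → Adj G x c → numEdges G ≡ componentSize x c + suc (componentSize c x)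
  numEdges≡ {x} {c} xc = begin
    numEdges G
      ≡⟨ cong length (filter-≐ isEdge? three-parts (edge-trichotomy xc) pairs) ⟩
    length (filter three-parts pairs)
      ≡⟨ length-filter-∪ (componentEdge? x c) two-parts x-side-apart pairs ⟩
    componentSize x c + length (filter two-parts pairs)
      ≡⟨ cong (componentSize x c +_) (length-filter-∪ (edgeBetween? x c) (componentEdge? c x) edge-apart pairs) ⟩
    componentSize x c + (length (filter (edgeBetween? x c) pairs) + componentSize c x)
      ≡⟨ cong (λ k → componentSize x c + (k + componentSize c x)) (edgeBetween-count xc) ⟩
    componentSize x c + suc (componentSize c x)
      ∎
    where
      open ≡-Reasoning
      two-parts = edgeBetween? x c ∪? componentEdge? c x
      three-parts = componentEdge? x c ∪? two-parts
      edge-apart : ∀ {p} → EdgeBetween x c p → ¬ InComponentEdge G c x p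
      edge-apart (_ , inj₁ (refl , refl)) (_ , _ , _ , xc) = avoid-tgt xc refl
      edge-apart (_ , inj₂ (refl , refl)) (_ , _ , xc , _) = avoid-tgt xc refl
      x-side-apart : ∀ {p} → InComponentEdge G x c p → ¬ (EdgeBetween x c ∪ InComponentEdge G c x) p
      x-side-apart (_ , _ , cx , _) (inj₁ (_ , inj₁ (refl , refl))) = avoid-tgt cx refl
      x-side-apart (_ , _ , _ , cx) (inj₁ (_ , inj₂ (refl , refl))) = avoid-tgt cx refl
      x-side-apart (_ , _ , cu , _) (inj₂ (_ , _ , xu , _))         = sides-disjoint xc cu xu

  componentSize-< : ∀ {x c d} → Adj G x c → Adj G c d → d ≢ x → componentSize c d < componentSize x c
  componentSize-< {x} {c} {d} xc cd d≢x with edgeBetween-exists cd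
  ... | p , p-cd = length-filter-< (componentEdge? c d) (componentEdge? x c) nested
                     pairs (∈-pairs p) (in-x-side p-cd) (not-in-d-side p-cd)
    where
      c≢x = adj⇒≢ xc ∘ ≡-sym
      cd-avoiding-x = step c≢x cd (here d≢x)
      nested : InComponentEdge G c d ⊆ InComponentEdge G x c
      nested (u<v , uv , du , dv) = u<v , uv , side-nested xc cd d≢x du , side-nested xc cd d≢x dv
      in-x-side : ∀ {p} → EdgeBetween c d p → InComponentEdge G x c p
      in-x-side ((u<v , uv) , inj₁ (refl , refl)) = u<v , uv , here c≢x , cd-avoiding-x
      in-x-side ((u<v , uv) , inj₂ (refl , refl)) = u<v , uv , cd-avoiding-x , here c≢x
      not-in-d-side : ∀ {p} → EdgeBetween c d p → ¬ InComponentEdge G c d p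
      not-in-d-side (_ , inj₁ (refl , refl)) (_ , _ , dc , _) = avoid-tgt dc refl
      not-in-d-side (_ , inj₂ (refl , refl)) (_ , _ , _ , dc) = avoid-tgt dc refl

  all-components-even : ∀ {x} → (∀ d → Adj G x d → Even (componentSize x d)) → AllComponentsEven G x
  all-components-even even-at y y≢x E enum with neighbour-towards y≢x
  ... | d , xd , dy = subst Even (≡-sym (trans (enumeration-length enum) (componentSize-cong dy))) (even-at d xd)

  adjacent⇒even? : ∀ x → Decidable (λ d → Adj G x d → Even (componentSize x d))
  adjacent⇒even? x d = T? (adj G x d) →-dec (2 ∣? componentSize x d)

  even-everywhere-or-odd-neighbour : ∀ x → (∀ d → Adj G x d → Even (componentSize x d))
                                         ⊎ ∃[ d ] Adj G x d × ¬ Even (componentSize x d)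
  even-everywhere-or-odd-neighbour x with all? (adjacent⇒even? x)
  ... | yes even-at = inj₁ even-at
  ... | no ¬even-at with ¬∀⟶∃¬ n _ (adjacent⇒even? x) ¬even-at
  ...   | d , ¬even-if-xd = inj₂ (d , xd , ¬even-if-xd ∘ const)
    where
      xd : Adj G x d
      xd = decidable-stable (T? (adj G x d)) λ ¬xd → ¬even-if-xd (⊥-elim ∘ ¬xd)

  module _ (even-edges : Even (numEdges G)) where

    far-side-even : ∀ {x c} → Adj G x c → ¬ Even (componentSize x c) → Even (componentSize c x)
    far-side-even xc = even-+-suc _ _ (subst Even (numEdges≡ xc) even-edges)

    descend : ∀ {x c} → Acc _<_ (componentSize x c) → Adj G x c → Even (componentSize c x) →
              ∃[ y ] AllComponentsEven G y
    descend {x} {c} (acc smaller) xc even-cx with even-everywhere-or-odd-neighbour c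
    ... | inj₁ even-at = c , all-components-even even-at
    ... | inj₂ (d , cd , odd-cd) with d ≟ x
    ...   | yes refl = ⊥-elim (odd-cd even-cx)
    ...   | no d≢x   = descend (smaller (componentSize-< xc cd d≢x)) cd (far-side-even cd odd-cd)

lemma4p3 : ∀ (n : ℕ) (T : Graph (suc n)) → IsTree T → Even (numEdges T) → ∃[ x ] AllComponentsEven T x
lemma4p3 n T (connected , acyclic) even-edges = case even-everywhere-or-odd-neighbour zeroᶠ of λ where
    (inj₁ even-at)           → zeroᶠ , all-components-even even-at
    (inj₂ (d , 0d , odd-0d)) → descend even-edges (<-wellFounded _) 0d (far-side-even even-edges 0d odd-0d)
  where open Tree T connected acyclic
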